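{- Let $G=(V,E,\lambda)$ be a temporal graph. Then there is an injective labeling function $\lambda'\colon E\to\mathbb{N}$ such that every spanner $S\subseteq E$ of $(V,E,\lambda')$ is also a spanner of $G$. Moreover, if $G$ is a temporal bi-clique $D=(A,B,\lambda)$, then there is an injective labeling $\lambda'$ such that every bi-spanner of $(A,B,\lambda')$ is also a bi-spanner of $D$.
   Context: A temporal graph is $G=(V,E,\lambda)$ with $(V,E)$ an undirected graph and $\lambda\colon E\to\mathbb{N}$. A path $v_1\dots v_k$ is a temporal path if $\lambda(\{v_i,v_{i+1}\})\le\lambda(\{v_{i+1},v_{i+2}\})$ for all $i\in[k-2]$. $G$ is temporally connected if every vertex can reach every other vertex via a temporal path. A spanner is a set $S\subseteq E$ such that $(V,S,\lambda|_S)$ is temporally connected. A temporal bi-clique $(A,B,\lambda)$ is a temporal graph on the complete bipartite graph with disjoint parts $A,B$; a bi-spanner is an edge set $S$ such that every $a\in A$ reaches every $b\in B$ via a temporal path within $S$. -}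

module Defs where

open import Data.Nat using (ℕ; suc; _≤_)
open import Data.Fin using (Fin; toℕ)
open import Data.Bool using (Bool; true)
open import Data.Product using (_×_; _,_; Σ; ∃; proj₁; proj₂)
open import Data.Sum using (_⊎_; inj₁; inj₂)
open import Relation.Binary.PropositionalEquality using (_≡_; _≢_)
open import Function.Definitions using (Injective)

-- A (static) graph is given by a vertex type V, an edge type E and an
-- endpoint map ends : E → V × V.  The edge e joins u and v (undirected):
Joins : {V E : Set} → (E → V × V) → E → V → V → Set
Joins ends e u v = (ends e ≡ (u , v)) ⊎ (ends e ≡ (v , u))

SimpleGraph : {n m : ℕ} → (Fin m → Fin n × Fin n) → Set
SimpleGraph {n} {m} ends =
  (∀ (e : Fin m) → proj₁ (ends e) ≢ proj₂ (ends e)) ×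
  (∀ (e f : Fin m) → Joins ends f (proj₁ (ends e)) (proj₂ (ends e)) → e ≡ f)

-- An edge subset S ⊆ E (a finite subset given by its characteristic function).
_∈S_ : {E : Set} → E → (E → Bool) → Set
e ∈S S = S e ≡ true

record TemporalPath {V E : Set} (ends : E → V × V) (lab : E → ℕ)
                    (S : E → Bool) (u w : V) : Set where
  field
    k     : ℕ
    vert  : Fin (suc k) → V
    edge  : Fin k → E
    distinct : Injective _≡_ _≡_ vert
    start : vert Data.Fin.zero ≡ u
    end   : vert (Data.Fin.fromℕ k) ≡ w
    inS   : ∀ (i : Fin k) → edge i ∈S S
    joins : ∀ (i : Fin k) →
              Joins ends (edge i) (vert (Data.Fin.inject₁ i)) (vert (Data.Fin.suc i))
    nondecreasing : ∀ (i j : Fin k) → toℕ j ≡ suc (toℕ i) →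
                      lab (edge i) ≤ lab (edge j)

Reaches : {V E : Set} → (E → V × V) → (E → ℕ) → (E → Bool) → V → V → Set
Reaches ends lab S u w = TemporalPath ends lab S u w

Spanner : {V E : Set} → (E → V × V) → (E → ℕ) → (E → Bool) → Set
Spanner {V} ends lab S = ∀ (u w : V) → u ≢ w → Reaches ends lab S u w

-- Temporal bi-clique (A, B, lab) with A = Fin a, B = Fin b (disjoint copies):
-- vertices Fin a ⊎ Fin b, edges Fin a × Fin b (the complete bipartite graph).
BiVertex : ℕ → ℕ → Set
BiVertex a b = Fin a ⊎ Fin b

BiEdge : ℕ → ℕ → Set
BiEdge a b = Fin a × Fin b

biEnds : {a b : ℕ} → BiEdge a b → BiVertex a b × BiVertex a b
biEnds (x , y) = (inj₁ x , inj₂ y)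

BiSpanner : (a b : ℕ) → (BiEdge a b → ℕ) → (BiEdge a b → Bool) → Set
BiSpanner a b lab S =
  ∀ (x : Fin a) (y : Fin b) → Reaches (biEnds {a} {b}) lab S (inj₁ x) (inj₂ y)

-- Break ties lexicographically: with the edges numbered injectively by
-- idx : E → Fin N, the labeling λ′(e) = λ(e)·N + idx(e) is injective, and
-- λ′(e) ≤ λ′(f) forces λ(e) ≤ λ(f).  Hence every temporal path for λ′ is a
-- temporal path for λ along the same vertices and edges, so (bi-)spanners of
-- the relabeled graph are (bi-)spanners of the original one.
module Submission where

open import Defs
open import Data.Nat using (ℕ; suc; _+_; _*_; _≤_; _<_; _≤?_)
open import Data.Nat.Properties
open import Data.Fin using (Fin; toℕ; combine)
open import Data.Fin.Properties using (toℕ<n; toℕ-injective; combine-injective)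
open import Data.Bool using (Bool)
open import Data.Product using (_×_; ∃; _,_; uncurry)
open import Data.Product.Properties using (×-≡,≡→≡)
open import Relation.Binary.PropositionalEquality using (_≡_; sym; trans; cong)
open import Relation.Nullary using (yes; no; contradiction)
open import Function using (id)
open import Function.Definitions using (Injective)

m*o+i≤n*o+j⇒m≤n : ∀ {m n o i j} → j < o → m * o + i ≤ n * o + j → m ≤ n
m*o+i≤n*o+j⇒m≤n {m} {n} {o} {i} {j} j<o le with m ≤? n
... | yes m≤n = m≤n
... | no m≰n = contradiction le (<⇒≱ (n*o+j<m*o+i (≰⇒> m≰n)))
  where
  open ≤-Reasoning
  n*o+j<m*o+i : n < m → n * o + j < m * o + i
  n*o+j<m*o+i n<m = begin-strict
    n * o + j  <⟨ +-monoʳ-< (n * o) j<o ⟩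
    n * o + o  ≡⟨ +-comm (n * o) o ⟩
    suc n * o  ≤⟨ *-monoˡ-≤ o n<m ⟩
    m * o      ≤⟨ m≤m+n (m * o) i ⟩
    m * o + i  ∎

_Refines_ : {E : Set} → (E → ℕ) → (E → ℕ) → Set
lab′ Refines lab = ∀ {e f} → lab′ e ≤ lab′ f → lab e ≤ lab f

injective-refinement : {E : Set} {N : ℕ} (idx : E → Fin N) → Injective _≡_ _≡_ idx →
                       (lab : E → ℕ) →
                       ∃ λ (lab′ : E → ℕ) → Injective _≡_ _≡_ lab′ × lab′ Refines lab
injective-refinement {E} {N} idx idx-injective lab = lab′ , lab′-injective , refines
  where
  lab′ : E → ℕ
  lab′ e = lab e * N + toℕ (idx e)

  refines : lab′ Refines lab
  refines {f = f} = m*o+i≤n*o+j⇒m≤n (toℕ<n (idx f))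

  lab′-injective : Injective _≡_ _≡_ lab′
  lab′-injective {e} {f} eq =
    idx-injective (toℕ-injective (+-cancelˡ-≡ (lab e * N) _ _ same-tiebreak))
    where
    same-lab : lab e ≡ lab f
    same-lab = ≤-antisym (refines (≤-reflexive eq)) (refines (≤-reflexive (sym eq)))
    same-tiebreak : lab e * N + toℕ (idx e) ≡ lab e * N + toℕ (idx f)
    same-tiebreak = trans eq (cong (λ l → l * N + toℕ (idx f)) (sym same-lab))

TemporalPath-coarsen : {V E : Set} {ends : E → V × V} {lab′ lab : E → ℕ} {S : E → Bool} {u w : V} →
                       lab′ Refines lab → TemporalPath ends lab′ S u w → TemporalPath ends lab S u w
TemporalPath-coarsen refines p = record
  { k = k ; vert = vert ; edge = edge ; distinct = distinct ; start = start ; end = end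
  ; inS = inS ; joins = joins
  ; nondecreasing = λ i j j≡1+i → refines (nondecreasing i j j≡1+i)
  }
  where open TemporalPath p

Spanner-coarsen : {V E : Set} {ends : E → V × V} {lab′ lab : E → ℕ} {S : E → Bool} →
                  lab′ Refines lab → Spanner ends lab′ S → Spanner ends lab S
Spanner-coarsen refines spanner u w u≢w = TemporalPath-coarsen refines (spanner u w u≢w)

BiSpanner-coarsen : ∀ {a b} {lab′ lab : BiEdge a b → ℕ} {S : BiEdge a b → Bool} →
                    lab′ Refines lab → BiSpanner a b lab′ S → BiSpanner a b lab S
BiSpanner-coarsen refines bi-spanner x y = TemporalPath-coarsen refines (bi-spanner x y)

combine-uncurried-injective : ∀ {a b} → Injective _≡_ _≡_ (uncurry (combine {a} {b}))
combine-uncurried-injective {x = x , y} {y = x′ , y′} eq = ×-≡,≡→≡ (combine-injective x y x′ y′ eq)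

lemma4 : (∀ (n m : ℕ) (ends : Fin m → Fin n × Fin n) → SimpleGraph ends →
    (lab : Fin m → ℕ) →
    ∃ λ (lab′ : Fin m → ℕ) → Injective _≡_ _≡_ lab′ ×
    (∀ (S : Fin m → Bool) → Spanner ends lab′ S → Spanner ends lab S))
    ×
    (∀ (a b : ℕ) (lab : BiEdge a b → ℕ) →
    ∃ λ (lab′ : BiEdge a b → ℕ) → Injective _≡_ _≡_ lab′ ×
    (∀ (S : BiEdge a b → Bool) → BiSpanner a b lab′ S → BiSpanner a b lab S))
lemma4 =
    (λ _ _ _ _ lab →
      let lab′ , lab′-injective , refines = injective-refinement id id lab
      in  lab′ , lab′-injective , λ S → Spanner-coarsen refines)
  , (λ _ _ lab →
      let lab′ , lab′-injective , refines =
            injective-refinement (uncurry combine) combine-uncurried-injective lab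
      in  lab′ , lab′-injective , λ S → BiSpanner-coarsen refines)
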